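{- Let $S$ be a closed context-free semi-Thue system over $\Sigma$. The contraction rule $\mathit{ctr}$ (deriving $\Gamma,\Delta$ from $\Gamma,\Delta,\Delta$) is admissible in the system $\mathrm{DKm}(S)$ extended with the rules $\mathit{actr}$ (deriving $\Gamma[A]$ from $\Gamma[A,A]$, for a formula $A$) and $m$ (deriving $\Gamma[a\{\Delta_1,\Delta_2\}]$ from $\Gamma[a\{\Delta_1\},a\{\Delta_2\}]$).
   Context: $\Sigma$: alphabet with involution $a\mapsto\bar a$; $\overline{a_1\cdots a_n}=\bar a_n\cdots\bar a_1$. A semi-Thue system $S$ is a set of rules $u\to v$ ($u,v\in\Sigma^*$); closed if $u\to v\in S\Rightarrow\bar u\to\bar v\in S$; context-free if all rules have form $a\to u$, $a\in\Sigma$. $L_a(S)=\{u\mid a\Rightarrow_S u\}$. Formulae are in negation normal form. A nested sequent is a finite multiset of formulae and structures $a\{\Delta\}$ (comma = multiset union), viewed as a tree with nodes carrying multisets of formulae and $\Sigma$-labelled edges. Contexts $\Gamma[\ ]$, $\Gamma[\ ]_i[\ ]_j$ have holes at nodes. $\mathcal R(\Gamma,i,j)$: automaton with the nodes as states, initial $i$, final $j$, transitions $x\xrightarrow{a}y$, $y\xrightarrow{\bar a}x$ for each edge $x\xrightarrow{a}y$. $\mathrm{DKm}(S)$ rules (conclusion from premises): $\mathit{id}_d$: $\Gamma[p,\neg p]$; $\land_d$: $\Gamma[A\land B]$ from $\Gamma[A\land B,A]$, $\Gamma[A\land B,B]$; $\lor_d$: $\Gamma[A\lor B]$ from $\Gamma[A\lor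 B,A,B]$; $[a]_d$: $\Gamma[[a]A]$ from $\Gamma[[a]A,a\{A\}]$; $\langle a\rangle\!\uparrow$: $\Gamma[a\{\Delta\},\langle a\rangle A]$ from $\Gamma[a\{\Delta,A\},\langle a\rangle A]$; $\langle a\rangle\!\downarrow$: $\Gamma[a\{\Delta,\langle\bar a\rangle A\}]$ from $\Gamma[a\{\Delta,\langle\bar a\rangle A\},A]$; $p_S$: $\Gamma[\langle a\rangle A]_i[\emptyset]_j$ from $\Gamma[\langle a\rangle A]_i[A]_j$ provided $\mathcal R(\Gamma[\ ]_i[\ ]_j,i,j)\cap L_a(S)\neq\emptyset$. A rule is admissible in a system if derivability of its premises implies derivability of its conclusion. -}

module Defs where

open import Data.List using (List; []; _∷_; _++_; map; reverse; [_])
open import Data.List.Membership.Propositional using (_∈_)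
open import Data.List.Relation.Unary.Any using (here; there)
open import Data.Product using (Σ; ∃; ∃-syntax; _×_; _,_)
open import Relation.Binary.PropositionalEquality using (_≡_)
open import Relation.Binary.Construct.Closure.ReflexiveTransitive using (Star)

module _ {Sym : Set} where

  data Step (S : List Sym → List Sym → Set) : List Sym → List Sym → Set where
    step : ∀ {u v} (x y : List Sym) → S u v → Step S (x ++ u ++ y) (x ++ v ++ y)

  _⇒*[_]_ : List Sym → (List Sym → List Sym → Set) → List Sym → Set
  u ⇒*[ S ] v = Star (Step S) u v

  InL : (S : List Sym → List Sym → Set) → Sym → List Sym → Set
  InL S a u = [ a ] ⇒*[ S ] u

  barW : (Sym → Sym) → List Sym → List Sym
  barW bar u = reverse (map bar u)

  Closed : (Sym → Sym) → (List Sym → List Sym → Set) → Set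
  Closed bar S = ∀ {u v} → S u v → S (barW bar u) (barW bar v)

  ContextFree : (List Sym → List Sym → Set) → Set
  ContextFree S = ∀ {u v} → S u v → ∃[ a ] (u ≡ [ a ])

data Fml (Sym At : Set) : Set where
  atom  : At → Fml Sym At
  natom : At → Fml Sym At
  _∧_   : Fml Sym At → Fml Sym At → Fml Sym At
  _∨_   : Fml Sym At → Fml Sym At → Fml Sym At
  ⟦_⟧_  : Sym → Fml Sym At → Fml Sym At
  ⟨_⟩_  : Sym → Fml Sym At → Fml Sym At

-- Nested sequents: finite lists of items, read as multisets up to _~_ below.
data Item (Sym At : Set) : Set where
  fml : Fml Sym At → Item Sym At
  box : Sym → List (Item Sym At) → Item Sym At

Seq : Set → Set → Set
Seq Sym At = List (Item Sym At)

module _ {Sym At : Set} where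

  data _~_ : Seq Sym At → Seq Sym At → Set where
    ~refl  : ∀ {Γ} → Γ ~ Γ
    ~sym   : ∀ {Γ Δ} → Γ ~ Δ → Δ ~ Γ
    ~trans : ∀ {Γ Δ Θ} → Γ ~ Δ → Δ ~ Θ → Γ ~ Θ
    ~swap  : ∀ {x y Γ} → (x ∷ y ∷ Γ) ~ (y ∷ x ∷ Γ)
    ~cons  : ∀ {x Γ Δ} → Γ ~ Δ → (x ∷ Γ) ~ (x ∷ Δ)
    ~box   : ∀ {a Δ Δ' Γ} → Δ ~ Δ' → (box a Δ ∷ Γ) ~ (box a Δ' ∷ Γ)

  -- nodes of the tree of a sequent (paths from the root)
  data Pos : Seq Sym At → Set where
    root : ∀ {Γ} → Pos Γ
    into : ∀ {Γ a Δ} → box a Δ ∈ Γ → Pos Δ → Pos Γ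

  upd : ∀ {x : Item Sym At} (Γ : Seq Sym At) → x ∈ Γ → Item Sym At → Seq Sym At
  upd (_ ∷ Γ) (here _)  z = z ∷ Γ
  upd (y ∷ Γ) (there m) z = y ∷ upd Γ m z

  -- filling a context: Γ[X] where the context is (Γ , i), i the hole's node
  ins : (Γ : Seq Sym At) → Pos Γ → Seq Sym At → Seq Sym At
  ins Γ root X = Γ ++ X
  ins Γ (into {a = a} {Δ} m p) X = upd Γ m (box a (ins Δ p X))

  nodeAt : (Γ : Seq Sym At) → Pos Γ → Seq Sym At
  nodeAt Γ root = Γ
  nodeAt Γ (into {Δ = Δ} m p) = nodeAt Δ p

  data Edge : (Γ : Seq Sym At) → Pos Γ → Sym → Pos Γ → Set where
    down : ∀ {Γ a Δ} (m : box a Δ ∈ Γ) → Edge Γ root a (into m root)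
    deep : ∀ {Γ b Δ x a y} (m : box b Δ ∈ Γ) → Edge Δ x a y →
           Edge Γ (into m x) a (into m y)

  -- runs of the automaton R(Γ,i,j): for each edge x -a-> y, transitions
  -- x -a-> y and y -(bar a)-> x.
  data Run (bar : Sym → Sym) (Γ : Seq Sym At) : Pos Γ → List Sym → Pos Γ → Set where
    stop : ∀ {x} → Run bar Γ x [] x
    fwd  : ∀ {x a y w z} → Edge Γ x a y → Run bar Γ y w z → Run bar Γ x (a ∷ w) z
    bwd  : ∀ {x a y w z} → Edge Γ y a x → Run bar Γ y w z → Run bar Γ x (bar a ∷ w) z

  PathCond : (Sym → Sym) → (List Sym → List Sym → Set) →
             (Γ : Seq Sym At) → Pos Γ → Pos Γ → Sym → Set
  PathCond bar S Γ i j a = ∃[ w ] (Run bar Γ i w j × InL S a w)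

  data Der (bar : Sym → Sym) (S : List Sym → List Sym → Set) : Seq Sym At → Set where
    mset : ∀ {Γ Γ'} → Γ ~ Γ' → Der bar S Γ' → Der bar S Γ
    idd  : ∀ Γ i p → Der bar S (ins Γ i (fml (atom p) ∷ fml (natom p) ∷ []))
    ∧d   : ∀ Γ i A B →
           Der bar S (ins Γ i (fml (A ∧ B) ∷ fml A ∷ [])) →
           Der bar S (ins Γ i (fml (A ∧ B) ∷ fml B ∷ [])) →
           Der bar S (ins Γ i (fml (A ∧ B) ∷ []))
    ∨d   : ∀ Γ i A B →
           Der bar S (ins Γ i (fml (A ∨ B) ∷ fml A ∷ fml B ∷ [])) →
           Der bar S (ins Γ i (fml (A ∨ B) ∷ []))
    □d   : ∀ Γ i a A →
           Der bar S (ins Γ i (fml (⟦ a ⟧ A) ∷ box a (fml A ∷ []) ∷ [])) →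
           Der bar S (ins Γ i (fml (⟦ a ⟧ A) ∷ []))
    ◇↑   : ∀ Γ i a Δ A →
           Der bar S (ins Γ i (box a (Δ ++ fml A ∷ []) ∷ fml (⟨ a ⟩ A) ∷ [])) →
           Der bar S (ins Γ i (box a Δ ∷ fml (⟨ a ⟩ A) ∷ []))
    ◇↓   : ∀ Γ i a Δ A →
           Der bar S (ins Γ i (box a (Δ ++ fml (⟨ bar a ⟩ A) ∷ []) ∷ fml A ∷ [])) →
           Der bar S (ins Γ i (box a (Δ ++ fml (⟨ bar a ⟩ A) ∷ []) ∷ []))
    -- p_S: conclusion Γ[⟨a⟩A]_i[∅]_j , premise Γ[⟨a⟩A]_i[A]_j
    pS   : ∀ Γ (i j : Pos Γ) a A →
           fml (⟨ a ⟩ A) ∈ nodeAt Γ i →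
           PathCond bar S Γ i j a →
           Der bar S (ins Γ j (fml A ∷ [])) →
           Der bar S Γ
    actr : ∀ Γ i A →
           Der bar S (ins Γ i (fml A ∷ fml A ∷ [])) →
           Der bar S (ins Γ i (fml A ∷ []))
    mrg  : ∀ Γ i a Δ₁ Δ₂ →
           Der bar S (ins Γ i (box a Δ₁ ∷ box a Δ₂ ∷ [])) →
           Der bar S (ins Γ i (box a (Δ₁ ++ Δ₂) ∷ []))

  CtrAdmissible : (Sym → Sym) → (List Sym → List Sym → Set) → Set
  CtrAdmissible bar S = ∀ (Γ Δ : Seq Sym At) →
    Der bar S (Γ ++ Δ ++ Δ) → Der bar S (Γ ++ Δ)

-- Contraction of a whole sequent Δ is reduced to contraction of its items one at
-- a time, in a hole of an arbitrary context.  A duplicated formula is contracted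
-- by actr; a duplicated structure a{Θ}, a{Θ} is merged by m into a{Θ,Θ}, after
-- which Θ is contracted recursively one level deeper.
module Submission where

open import Defs
open import Data.List using (List; []; _∷_; _++_; [_])
open import Data.List.Properties using (++-assoc)
open import Data.List.Membership.Propositional using (_∈_)
open import Data.List.Relation.Unary.Any using (here; there)
open import Data.List.Relation.Unary.Any.Properties using (++⁺ʳ)
open import Data.List.Relation.Binary.Permutation.Propositional
  using (_↭_; refl; prep; swap; trans; ↭-sym)
open import Data.List.Relation.Binary.Permutation.Propositional.Properties
  using (++-comm; shift)
import Relation.Binary.PropositionalEquality as ≡
open ≡ using (_≡_; cong; subst)

module _ {Sym At : Set} where

  ↭⇒~ : {Γ Δ : Seq Sym At} → Γ ↭ Δ → Γ ~ Δ
  ↭⇒~ refl          = ~refl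
  ↭⇒~ (prep _ p)    = ~cons (↭⇒~ p)
  ↭⇒~ (swap _ _ p)  = ~trans ~swap (~cons (~cons (↭⇒~ p)))
  ↭⇒~ (trans p q)   = ~trans (↭⇒~ p) (↭⇒~ q)

  ++-~-congˡ : (Γ : Seq Sym At) {Δ Δ' : Seq Sym At} → Δ ~ Δ' → (Γ ++ Δ) ~ (Γ ++ Δ')
  ++-~-congˡ []      p = p
  ++-~-congˡ (_ ∷ Γ) p = ~cons (++-~-congˡ Γ p)

  upd-~-cong : ∀ {x} (Γ : Seq Sym At) (m : x ∈ Γ) (a : Sym) {Δ Δ' : Seq Sym At} →
               Δ ~ Δ' → upd Γ m (box a Δ) ~ upd Γ m (box a Δ')
  upd-~-cong (_ ∷ _) (here _)  a p = ~box p
  upd-~-cong (_ ∷ Γ) (there m) a p = ~cons (upd-~-cong Γ m a p)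

  ins-~-cong : (Γ : Seq Sym At) (i : Pos Γ) {X Y : Seq Sym At} →
               X ~ Y → ins Γ i X ~ ins Γ i Y
  ins-~-cong Γ root                    p = ++-~-congˡ Γ p
  ins-~-cong Γ (into {a = a} {Δ} m i) p = upd-~-cong Γ m a (ins-~-cong Δ i p)

  ∈-upd : ∀ {x} (Γ : Seq Sym At) (m : x ∈ Γ) (z : Item Sym At) → z ∈ upd Γ m z
  ∈-upd (_ ∷ _) (here _)  z = here ≡.refl
  ∈-upd (_ ∷ Γ) (there m) z = there (∈-upd Γ m z)

  upd-upd : ∀ {x} (Γ : Seq Sym At) (m : x ∈ Γ) (z w : Item Sym At) →
            upd (upd Γ m z) (∈-upd Γ m z) w ≡ upd Γ m w
  upd-upd (_ ∷ _) (here _)  z w = ≡.refl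
  upd-upd (y ∷ Γ) (there m) z w = cong (y ∷_) (upd-upd Γ m z w)

  upd-++⁺ʳ : ∀ {x} (Γ Δ : Seq Sym At) (m : x ∈ Δ) (z : Item Sym At) →
             upd (Γ ++ Δ) (++⁺ʳ Γ m) z ≡ Γ ++ upd Δ m z
  upd-++⁺ʳ []      Δ m z = ≡.refl
  upd-++⁺ʳ (y ∷ Γ) Δ m z = cong (y ∷_) (upd-++⁺ʳ Γ Δ m z)

  Pos-++ʳ : (Γ : Seq Sym At) {Δ : Seq Sym At} → Pos Δ → Pos (Γ ++ Δ)
  Pos-++ʳ Γ root       = root
  Pos-++ʳ Γ (into m p) = into (++⁺ʳ Γ m) p

  ins-Pos-++ʳ : (Γ Δ : Seq Sym At) (p : Pos Δ) (X : Seq Sym At) →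
                ins (Γ ++ Δ) (Pos-++ʳ Γ p) X ≡ Γ ++ ins Δ p X
  ins-Pos-++ʳ Γ Δ root                    X = ++-assoc Γ Δ X
  ins-Pos-++ʳ Γ Δ (into {a = a} {Θ} m p) X = upd-++⁺ʳ Γ Δ m (box a (ins Θ p X))

  inside : (Γ : Seq Sym At) (i : Pos Γ) {Y : Seq Sym At} → Pos Y → Pos (ins Γ i Y)
  inside Γ root p = Pos-++ʳ Γ p
  inside Γ (into {a = a} {Δ} m i) {Y} p =
    into (∈-upd Γ m (box a (ins Δ i Y))) (inside Δ i p)

  ins-inside : (Γ : Seq Sym At) (i : Pos Γ) (Y : Seq Sym At) (p : Pos Y) (X : Seq Sym At) →
               ins (ins Γ i Y) (inside Γ i p) X ≡ ins Γ i (ins Y p X)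
  ins-inside Γ root Y p X = ins-Pos-++ʳ Γ Y p X
  ins-inside Γ (into {a = a} {Δ} m i) Y p X = begin
    upd (upd Γ m (box a (ins Δ i Y))) (∈-upd Γ m _)
        (box a (ins (ins Δ i Y) (inside Δ i p) X))
      ≡⟨ upd-upd Γ m _ _ ⟩
    upd Γ m (box a (ins (ins Δ i Y) (inside Δ i p) X))
      ≡⟨ cong (λ Z → upd Γ m (box a Z)) (ins-inside Δ i Y p X) ⟩
    upd Γ m (box a (ins Δ i (ins Y p X)))
      ∎
    where open ≡.≡-Reasoning

module _ {Sym At : Set} (bar : Sym → Sym) (S : List Sym → List Sym → Set) where

  private
    Sq = Seq Sym At

  reorder : (Γ : Sq) (i : Pos Γ) {X Y : Sq} → X ↭ Y →
            Der bar S (ins Γ i Y) → Der bar S (ins Γ i X)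
  reorder Γ i p = mset (ins-~-cong Γ i (↭⇒~ p))

  toInside : (Γ : Sq) (i : Pos Γ) (Y : Sq) (p : Pos Y) (X : Sq) →
             Der bar S (ins Γ i (ins Y p X)) → Der bar S (ins (ins Γ i Y) (inside Γ i p) X)
  toInside Γ i Y p X = subst (Der bar S) (≡.sym (ins-inside Γ i Y p X))

  fromInside : (Γ : Sq) (i : Pos Γ) (Y : Sq) (p : Pos Y) (X : Sq) →
               Der bar S (ins (ins Γ i Y) (inside Γ i p) X) → Der bar S (ins Γ i (ins Y p X))
  fromInside Γ i Y p X = subst (Der bar S) (ins-inside Γ i Y p X)

  mutual
    ctr-ins : (Γ : Sq) (i : Pos Γ) (Δ : Sq) →
              Der bar S (ins Γ i (Δ ++ Δ)) → Der bar S (ins Γ i Δ)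
    ctr-ins Γ i []      d = d
    ctr-ins Γ i (x ∷ Δ) d =
      fromInside Γ i [ x ] root Δ (ctr-ins (ins Γ i [ x ]) (inside Γ i root) Δ xΔΔ)
      where
        ΔΔxx : Der bar S (ins Γ i ((Δ ++ Δ) ++ x ∷ x ∷ []))
        ΔΔxx = reorder Γ i
                 (trans (++-comm (Δ ++ Δ) (x ∷ x ∷ [])) (prep x (↭-sym (shift x Δ Δ)))) d

        ΔΔx : Der bar S (ins Γ i ((Δ ++ Δ) ++ [ x ]))
        ΔΔx = fromInside Γ i (Δ ++ Δ) root [ x ]
                (ctr-item (ins Γ i (Δ ++ Δ)) (inside Γ i root) x
                  (toInside Γ i (Δ ++ Δ) root (x ∷ x ∷ []) ΔΔxx))

        xΔΔ : Der bar S (ins (ins Γ i [ x ]) (inside Γ i root) (Δ ++ Δ))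
        xΔΔ = toInside Γ i [ x ] root (Δ ++ Δ) (reorder Γ i (++-comm [ x ] (Δ ++ Δ)) ΔΔx)

    ctr-item : (Γ : Sq) (i : Pos Γ) (x : Item Sym At) →
               Der bar S (ins Γ i (x ∷ x ∷ [])) → Der bar S (ins Γ i [ x ])
    ctr-item Γ i (fml A)   d = actr Γ i A d
    ctr-item Γ i (box a Θ) d =
      fromInside Γ i [ box a [] ] inBox Θ
        (ctr-ins (ins Γ i [ box a [] ]) (inside Γ i inBox) Θ
          (toInside Γ i [ box a [] ] inBox (Θ ++ Θ) (mrg Γ i a Θ Θ d)))
      where
        inBox : Pos [ box a [] ]
        inBox = into (here ≡.refl) root

lemma4p6 : (Sym At : Set) (bar : Sym → Sym) → (∀ a → bar (bar a) ≡ a) →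
           (S : List Sym → List Sym → Set) →
           Closed bar S → ContextFree S →
           CtrAdmissible {Sym} {At} bar S
lemma4p6 Sym At bar _ S _ _ Γ Δ = ctr-ins bar S Γ root Δ
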